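{- Let $\mathbb{P}=(\mathcal{G},(\mathcal{D},\sqsubseteq),\delta)$ be a pattern multistructure and let $\mathcal{D}^*\subseteq\mathcal{D}$ be its set of support-closed descriptions. Then $\mathbb{P}_{ext}=ext[\mathcal{D}^*]$.
   Context: A pattern setup is a triple $(\mathcal{G},(\mathcal{D},\sqsubseteq),\delta)$ with $\mathcal{G}$ a set, $(\mathcal{D},\sqsubseteq)$ a poset and $\delta:\mathcal{G}\to\mathcal{D}$ a map. $ext(d)=\{g\in\mathcal{G}\mid d\sqsubseteq\delta(g)\}$; $ext[X]=\{ext(d)\mid d\in X\}$; $\mathbb{P}_{ext}=ext[\mathcal{D}]$; $cov(A)=\{d\in\mathcal{D}\mid\forall g\in A,\ d\sqsubseteq\delta(g)\}$; $cov^*(A)=\max(cov(A))$ (maximal elements w.r.t. $\sqsubseteq$). The setup is a pattern multistructure if $cov(A)=\{c\in\mathcal{D}\mid\exists x\in cov^*(A),\ c\sqsubseteq x\}$ for every $A\subseteq\mathcal{G}$. A description $d$ is support-closed if for every $c\in\mathcal{D}$ with $d\sqsubseteq c$, $c\neq d$, we have $ext(c)\subsetneq ext(d)$. -}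

module Defs where

open import Level using (Level; _⊔_)
open import Data.Product using (Σ; ∃; _×_; _,_)
open import Relation.Nullary using (¬_)
open import Relation.Unary using (Pred; _∈_; _⊆_; _⊂_; _≐_)
open import Relation.Binary.Bundles using (Poset)

-- A pattern setup (G, (D, ⊑), δ).  Subsets of G are predicates G → Set ℓ;
-- equality of descriptions is the poset's equivalence _≈_.
record PatternSetup (ℓ : Level) : Set (Level.suc ℓ) where
  field
    G     : Set ℓ
    DPos  : Poset ℓ ℓ ℓ
  open Poset DPos public renaming (Carrier to D; _≤_ to _⊑_)
  field
    δ     : G → D

  ext : D → Pred G ℓ
  ext d g = d ⊑ δ g

  -- ext[X] = { ext(d) | d ∈ X }, a set of subsets of G
  -- (membership of a subset taken up to extensional equality _≐_)
  extImage : Pred D ℓ → Pred (Pred G ℓ) ℓ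
  extImage X S = Σ D λ d → (d ∈ X) × (ext d ≐ S)

  Pext : Pred (Pred G ℓ) ℓ
  Pext S = Σ D λ d → ext d ≐ S

  cov : Pred G ℓ → Pred D ℓ
  cov A d = ∀ {g} → g ∈ A → d ⊑ δ g

  maxElems : Pred D ℓ → Pred D ℓ
  maxElems X x = (x ∈ X) × (∀ {y} → y ∈ X → x ⊑ y → x ≈ y)

  cov* : Pred G ℓ → Pred D ℓ
  cov* A = maxElems (cov A)

  belowCov* : Pred G ℓ → Pred D ℓ
  belowCov* A c = Σ D λ x → (x ∈ cov* A) × (c ⊑ x)

  IsMultistructure : Set (Level.suc ℓ)
  IsMultistructure = ∀ (A : Pred G ℓ) → cov A ≐ belowCov* A

  SupportClosed : Pred D ℓ
  SupportClosed d = ∀ (c : D) → d ⊑ c → ¬ (c ≈ d) → ext c ⊂ ext d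

module Submission where

-- Given a description d, consider its extent A = ext(d).  Since d
-- covers A, the multistructure property places d below some maximal cover
-- x ∈ cov*(A).  Then ext(x) = A: it is at most A because ext is antitone
-- and d ⊑ x, and at least A because x covers A.  Finally, any maximal
-- cover of any set is support-closed: a strict refinement c of x with the
-- same extent would again cover A, contradicting maximality of x.

open import Defs
open import Level using (Level)
open import Relation.Unary using (Pred; _∈_; _⊆_; _≐_)
open import Data.Product using (Σ; _×_; _,_)

module _ {ℓ : Level} (P : PatternSetup ℓ) where
  open PatternSetup P

  ext-antitone : ∀ {d c : D} → d ⊑ c → ext c ⊆ ext d
  ext-antitone d⊑c c⊑δg = trans d⊑c c⊑δg

  ⊆ext⇒cov : ∀ {A : Pred G ℓ} {d : D} → A ⊆ ext d → d ∈ cov A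
  ⊆ext⇒cov A⊆ext g∈A = A⊆ext g∈A

  maxCover⇒supportClosed : ∀ {A : Pred G ℓ} {x : D} →
    x ∈ cov* A → x ∈ SupportClosed
  maxCover⇒supportClosed (x-covers , x-maximal) c x⊑c c≉x =
    ext-antitone x⊑c , λ ext-x⊆ext-c →
      c≉x (Eq.sym (x-maximal (⊆ext⇒cov (λ g∈A → ext-x⊆ext-c (x-covers g∈A))) x⊑c))

  coverAbove⇒sameExt : ∀ {d x : D} → x ∈ cov (ext d) → d ⊑ x → ext x ≐ ext d
  coverAbove⇒sameExt x-covers d⊑x = ext-antitone d⊑x , x-covers

  extentOfMaxCover : IsMultistructure → (d : D) →
    Σ D λ x → (x ∈ cov* (ext d)) × (ext x ≐ ext d)
  extentOfMaxCover multi d with multi (ext d)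
  ... | cov⊆below , _ with cov⊆below (⊆ext⇒cov (λ g∈ext → g∈ext))
  ... | x , x-max@(x-covers , _) , d⊑x = x , x-max , coverAbove⇒sameExt x-covers d⊑x

theorem7p6 : ∀ {ℓ : Level} (P : PatternSetup ℓ) →
    PatternSetup.IsMultistructure P →
    PatternSetup.Pext P ≐ PatternSetup.extImage P (PatternSetup.SupportClosed P)
theorem7p6 P multi = toSupportClosed , fromSupportClosed
  where
  open PatternSetup P

  toSupportClosed : ∀ {S} → S ∈ Pext → S ∈ extImage SupportClosed
  toSupportClosed (d , (ext-d⊆S , S⊆ext-d)) with extentOfMaxCover P multi d
  ... | x , x-max , (ext-x⊆ext-d , ext-d⊆ext-x) =
    x , maxCover⇒supportClosed P x-max
      , (λ g∈ext-x → ext-d⊆S (ext-x⊆ext-d g∈ext-x))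
      , (λ g∈S → ext-d⊆ext-x (S⊆ext-d g∈S))

  fromSupportClosed : ∀ {S} → S ∈ extImage SupportClosed → S ∈ Pext
  fromSupportClosed (d , _ , ext-d≐S) = d , ext-d≐S
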